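{- In intensional Martin-Löf type theory with weak propositional truncation, let $X,Y:\mathcal U$ and let $f:X\to Y$ be weakly constant, i.e. $\prod_{x,y:X}f(x)=f(y)$. Then $f$ factors through $\lVert X\rVert$ (there is $\bar f:\lVert X\rVert\to Y$ with $\prod_{x:X}\bar f(|x|)=f(x)$) in each of the following cases: (1) $X$ is empty, i.e. $X\to\mathbf 0$; (2) $X$ is inhabited, i.e. $\mathbf 1\to X$; (3) $X$ has split support, i.e. $\lVert X\rVert\to X$; (4) $X$ has a weakly constant endofunction, i.e. $\sum_{g:X\to X}\prod_{x,y:X}g(x)=g(y)$; (5) there is some function $g:Y\to X$. Moreover, the conditions (3) and (4) are logically equivalent.
   Context: Intensional Martin-Löf type theory with a universe $\mathcal U$, $\Sigma$, $\Pi$, $+$, empty type $\mathbf 0$, unit type $\mathbf 1$ and identity types (J only; no UIP/K). $\mathrm{isProp}(A):\equiv\prod_{a,b:A}a=b$. Weak propositional truncation: for every $A:\mathcal U$ a type $\lVert A\rVert:\mathcal U$ with $|{ - }|:A\to\lVert A\rVert$, a proof of $\mathrm{isProp}(\lVert A\rVert)$, and $\mathrm{rec}:\prod_{P:\mathcal U}\mathrm{isProp}(P)\to(A\to P)\to\lVert A\rVert\to P$ (no judgmental computation rule). -}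

{-# OPTIONS --without-K #-}
module Defs where

open import Data.Empty using (⊥)
open import Data.Unit using (⊤)
open import Data.Product using (Σ; _×_)
open import Relation.Binary.PropositionalEquality using (_≡_)

isProp : Set → Set
isProp A = (a b : A) → a ≡ b

const : {X Y : Set} → (X → Y) → Set
const {X} f = (x y : X) → f x ≡ f y

-- Weak propositional truncation for the universe Set, as an assumed
-- structure: type former, constructor, propositionality, and the
-- non-dependent recursor (no computation rule).
record WeakTrunc : Set₁ where
  field
    ∥_∥      : Set → Set
    ∣_∣      : {A : Set} → A → ∥ A ∥
    ∥∥-isProp : {A : Set} → isProp ∥ A ∥
    ∥∥-rec   : {A : Set} (P : Set) → isProp P → (A → P) → ∥ A ∥ → P

module _ (T : WeakTrunc) where
  open WeakTrunc T

  Factors : {X Y : Set} → (X → Y) → Set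
  Factors {X} {Y} f = Σ (∥ X ∥ → Y) (λ f̄ → (x : X) → f̄ ∣ x ∣ ≡ f x)

  hasSplitSupport : Set → Set
  hasSplitSupport X = ∥ X ∥ → X

hasConstEndo : Set → Set
hasConstEndo X = Σ (X → X) const

{-# OPTIONS --without-K #-}
-- A weakly constant endofunction g on X has a propositional type of fixed
-- points Σ x, g x ≡ x, and every x gives the fixed point g x; so the recursor
-- maps ∥ X ∥ to a fixed point, i.e. to X. With split support s, f ∘ s factors a
-- weakly constant f. The other cases reduce to these: an empty or inhabited X
-- has split support, and g : Y → X gives the weakly constant endofunction g ∘ f.
module Submission where

open import Defs
open import Data.Empty using (⊥; ⊥-elim)
open import Data.Unit using (⊤; tt)
open import Data.Product using (_×_; Σ; _,_; proj₁)
open import Data.Product.Properties using (Σ-≡,≡→≡)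
open import Function.Base using (_∘_)
open import Function.Bundles using (_⇔_; mk⇔)
open import Relation.Binary.PropositionalEquality
open import Relation.Binary.PropositionalEquality.Properties using (trans-symˡ; trans-reflʳ)

module _ {A : Set} {u v w : A} where

  trans-cancelˡ : (p : u ≡ v) (q : u ≡ w) → trans p (trans (sym p) q) ≡ q
  trans-cancelˡ refl q = refl

  trans-sym-cancelˡ : (p : v ≡ u) (q : u ≡ w) → trans (sym p) (trans p q) ≡ q
  trans-sym-cancelˡ refl q = refl

const-∘ˡ : {X Y Z : Set} (h : Y → Z) {f : X → Y} → const f → const (h ∘ f)
const-∘ˡ h f-const x y = cong h (f-const x y)

Fix : {X : Set} → (X → X) → Set
Fix {X} g = Σ X λ x → g x ≡ x

subst-fixedPoint : {X : Set} (g : X → X) {x y : X} (r : x ≡ y) (p : g x ≡ x) →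
                   subst (λ z → g z ≡ z) r p ≡ trans (sym (cong g r)) (trans p r)
subst-fixedPoint g refl p = sym (trans-reflʳ p)

module _ {X : Set} {g : X → X} (g-const : const g) where

  -- Every path x ≡ y is sent by g to one canonical path g x ≡ g y.
  const-path : (x y : X) → g x ≡ g y
  const-path x y = trans (sym (g-const x x)) (g-const x y)

  cong-const : {x y : X} (r : x ≡ y) → cong g r ≡ const-path x y
  cong-const {x} refl = sym (trans-symˡ (g-const x x))

  Fix-isProp : isProp (Fix g)
  Fix-isProp (x , p) (y , q) = Σ-≡,≡→≡ (r , transported)
    where
    κ : g x ≡ g y
    κ = const-path x y

    r : x ≡ y
    r = trans (sym p) (trans κ q)

    transported : subst (λ z → g z ≡ z) r p ≡ q
    transported = begin
      subst (λ z → g z ≡ z) r p          ≡⟨ subst-fixedPoint g r p ⟩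
      trans (sym (cong g r)) (trans p r) ≡⟨ cong (λ k → trans (sym k) (trans p r)) (cong-const r) ⟩
      trans (sym κ) (trans p r)          ≡⟨ cong (trans (sym κ)) (trans-cancelˡ p (trans κ q)) ⟩
      trans (sym κ) (trans κ q)          ≡⟨ trans-sym-cancelˡ κ q ⟩
      q                                  ∎
      where open ≡-Reasoning

  toFix : X → Fix g
  toFix x = g x , g-const (g x) x

module _ (T : WeakTrunc) where
  open WeakTrunc T

  hasConstEndo⇒hasSplitSupport : {X : Set} → hasConstEndo X → hasSplitSupport T X
  hasConstEndo⇒hasSplitSupport (g , g-const) t =
    proj₁ (∥∥-rec (Fix g) (Fix-isProp g-const) (toFix g-const) t)

  hasSplitSupport⇒hasConstEndo : {X : Set} → hasSplitSupport T X → hasConstEndo X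
  hasSplitSupport⇒hasConstEndo s =
    (λ x → s ∣ x ∣) , λ x y → cong s (∥∥-isProp ∣ x ∣ ∣ y ∣)

  empty⇒hasSplitSupport : {X : Set} → (X → ⊥) → hasSplitSupport T X
  empty⇒hasSplitSupport ¬x t = ⊥-elim (∥∥-rec ⊥ (λ ()) ¬x t)

  inhabited⇒hasSplitSupport : {X : Set} → (⊤ → X) → hasSplitSupport T X
  inhabited⇒hasSplitSupport x _ = x tt

  hasSplitSupport⇒Factors : {X Y : Set} (f : X → Y) → const f →
                            hasSplitSupport T X → Factors T f
  hasSplitSupport⇒Factors f f-const s = (λ t → f (s t)) , λ x → f-const (s ∣ x ∣) x

theorem5p3 : (T : WeakTrunc) →
    ((X Y : Set) (f : X → Y) → const f →
    ((X → ⊥) → Factors T f)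
    × ((⊤ → X) → Factors T f)
    × (hasSplitSupport T X → Factors T f)
    × (hasConstEndo X → Factors T f)
    × ((Y → X) → Factors T f))
    × ((X : Set) → hasSplitSupport T X ⇔ hasConstEndo X)
theorem5p3 T =
    (λ X Y f f-const →
      let split = hasSplitSupport⇒Factors T f f-const in
        (λ ¬x → split (empty⇒hasSplitSupport T ¬x))
      , (λ x → split (inhabited⇒hasSplitSupport T x))
      , split
      , (λ e → split (hasConstEndo⇒hasSplitSupport T e))
      , (λ g → split (hasConstEndo⇒hasSplitSupport T (g ∘ f , const-∘ˡ g f-const))))
  , λ X → mk⇔ (hasSplitSupport⇒hasConstEndo T) (hasConstEndo⇒hasSplitSupport T)
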